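{- Let $n\ge 3$ and let $W_n$ be the wheel graph on $n+1$ vertices. Then \[Z_{(\ell)}(W_n) = \begin{cases} 3 & \text{if } \ell \in\{0,1\},\\ \lceil 2n/3\rceil + 1 & \text{if } \ell = 2,\\ n & \text{if } n > \ell > 2,\\ n+1 & \text{if } \ell \in\{ n, n+1\}.\end{cases}\]
   Context: The wheel $W_n$ is obtained from the cycle $C_n$ by adding one new vertex (the center) adjacent to all $n$ vertices of the cycle. Let $G=(V,E)$ be a finite simple graph. Color-change rule (zero forcing): given a set of colored vertices, a colored vertex with exactly one uncolored neighbor colors ("forces") that neighbor. Leaks: for a set $L\subseteq V$, placing a leak on each $v\in L$ means attaching to $v$ one new pendant vertex (adjacent only to $v$) which is never initially colored; consequently no vertex of $L$ can ever force a vertex of $V$. A set $S\subseteq V$ is an $\ell$-forcing set if for every $L\subseteq V$ with $|L|\le \ell$, starting with exactly the vertices of $S$ colored and repeatedly applying the color-change rule in the graph with leaks on $L$, every vertex of $V$ eventually becomes colored. $Z_{(\ell)}(G)$ is the minimum size of an $\ell$-forcing set. -}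

module Defs where

open import Data.Nat using (ℕ; zero; suc; _+_; _*_; _≤_; _%_)
open import Data.Fin using (Fin; toℕ) renaming (zero to fzero; suc to fsuc)
open import Data.Fin.Subset using (Subset; _∈_; ∣_∣)
open import Data.Product using (Σ; _×_; _,_)
open import Data.Sum using (_⊎_; inj₁; inj₂)
open import Data.Unit using (⊤; tt)
open import Data.Empty using (⊥)
open import Relation.Nullary using (¬_)
open import Relation.Binary.PropositionalEquality using (_≡_; _≢_; refl) renaming (sym to sym≡)

record Graph (m : ℕ) : Set₁ where
  field
    Adj   : Fin m → Fin m → Set
    sym   : ∀ {u v} → Adj u v → Adj v u
    irrefl : ∀ {u} → ¬ Adj u u
open Graph public

-- Colored G S L v : vertex v eventually becomes colored when the vertices of S
-- are initially colored and leaks are placed on the vertices of L.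
-- (Least fixed point of the color-change rule; the color-change process is
-- monotone, so its final colored set is exactly this closure.)
-- A vertex u with a leak has an uncolored pendant neighbour forever, so it can
-- never force a vertex of V; a vertex u ∉ L forces v when v is its only
-- neighbour that is not (yet) colored.
data Colored {m : ℕ} (G : Graph m) (S L : Subset m) : Fin m → Set where
  init  : ∀ {v} → v ∈ S → Colored G S L v
  force : ∀ {u v} → Colored G S L u → ¬ (u ∈ L) → Adj G u v →
          (∀ w → Adj G u w → w ≢ v → Colored G S L w) →
          Colored G S L v

IsLForcing : {m : ℕ} → Graph m → ℕ → Subset m → Set
IsLForcing {m} G ℓ S = ∀ (L : Subset m) → ∣ L ∣ ≤ ℓ → ∀ v → Colored G S L v

ZeroForcingℓ≡ : {m : ℕ} → Graph m → ℕ → ℕ → Set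
ZeroForcingℓ≡ {m} G ℓ k =
  Σ (Subset m) (λ S → IsLForcing G ℓ S × ∣ S ∣ ≡ k)
  × (∀ (S : Subset m) → IsLForcing G ℓ S → k ≤ ∣ S ∣)

CycleAdj : (n : ℕ) → Fin n → Fin n → Set
CycleAdj n i j = (suc (toℕ i) % suc (predN n) ≡ toℕ j ⊎ suc (toℕ j) % suc (predN n) ≡ toℕ i) × (i ≢ j)
  where
    predN : ℕ → ℕ
    predN zero = zero
    predN (suc k) = k

WheelAdj : (n : ℕ) → Fin (suc n) → Fin (suc n) → Set
WheelAdj n fzero    fzero    = ⊥
WheelAdj n fzero    (fsuc j) = ⊤
WheelAdj n (fsuc i) fzero    = ⊤
WheelAdj n (fsuc i) (fsuc j) = CycleAdj n i j

wheel-sym : (n : ℕ) → ∀ {u v} → WheelAdj n u v → WheelAdj n v u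
wheel-sym n {fzero}  {fsuc j} a = tt
wheel-sym n {fsuc i} {fzero}  a = tt
wheel-sym n {fsuc i} {fsuc j} (inj₁ p , q) = inj₂ p , λ e → q (sym≡ e)
wheel-sym n {fsuc i} {fsuc j} (inj₂ p , q) = inj₁ p , λ e → q (sym≡ e)

wheel-irrefl : (n : ℕ) → ∀ {u} → ¬ WheelAdj n u u
wheel-irrefl n {fzero} ()
wheel-irrefl n {fsuc i} (_ , q) = q refl

Wheel : (n : ℕ) → Graph (suc n)
Wheel n = record { Adj = WheelAdj n ; sym = wheel-sym n ; irrefl = wheel-irrefl n }

module Submission where

-- The hub and two consecutive rim vertices force the whole rim around the cycle; with one
-- leak the rim is swept from both sides of it.  Every vertex has three neighbours, so fewer
-- than three coloured vertices never force anything.  With two leaks, two uncoloured rim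
-- vertices at distance one or two are shielded by leaking their outer neighbours, so the holes
-- of a 2-forcing set are at distance at least three: every window of three consecutive rim
-- vertices contains at most one hole, which bounds the holes by ⌊n/3⌋, and by one less when
-- the hub is missing, since then at least three windows must be full (leaking their middles
-- stalls the process).  Holes at the positions ≡ 2 (mod 3) attain the bound.  For ℓ ≥ 3,
-- leaking the neighbourhood of a rim vertex shows that it lies in every ℓ-forcing set, and
-- for ℓ ≥ n the same holds for the hub.

open import Defs renaming (sym to Adj-sym; irrefl to Adj-irrefl)
open import Data.Bool.Base using (Bool; true; false; not; _∧_; if_then_else_)
open import Data.Empty using (⊥-elim)
open import Data.Fin.Base using (Fin; toℕ) renaming (zero to fzero; suc to fsuc)
open import Data.Fin.Properties using (toℕ-injective; toℕ-fromℕ<; toℕ<n; ¬∀⟶∃¬)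
  renaming (_≟_ to _≟ᶠ_)
open import Data.Fin.Permutation using (Permutation; permutation; flip)
open import Data.Fin.Subset
open import Data.Fin.Subset.Properties
open import Data.Nat.Base
open import Data.Nat.DivMod
open import Data.Nat.Properties
open import Algebra.Properties.CommutativeMonoid.Sum +-0-commutativeMonoid
  using (sum; ∑-distrib-+; sum-permute)
open import Data.Product using (_×_; _,_; proj₁; proj₂)
open import Data.Sum using (_⊎_; inj₁; inj₂)
open import Data.Unit using (tt)
open import Data.Vec.Base using ([]; _∷_; lookup; tabulate; here; there)
open import Data.Vec.Properties using (lookup∘tabulate; lookup-map; []=⇒lookup; lookup⇒[]=)
open import Function.Base using (_∘_)
open import Relation.Nullary using (¬_; Dec; yes; no; does)
open import Relation.Binary.PropositionalEquality

private
  variable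
    m n ℓ : ℕ

∣p∪q∣≤∣p∣+∣q∣ : (p q : Subset n) → ∣ p ∪ q ∣ ≤ ∣ p ∣ + ∣ q ∣
∣p∪q∣≤∣p∣+∣q∣ []          []          = z≤n
∣p∪q∣≤∣p∣+∣q∣ (true ∷ p)  (true ∷ q)  =
  s≤s (≤-trans (∣p∪q∣≤∣p∣+∣q∣ p q) (+-monoʳ-≤ ∣ p ∣ (n≤1+n ∣ q ∣)))
∣p∪q∣≤∣p∣+∣q∣ (true ∷ p)  (false ∷ q) = s≤s (∣p∪q∣≤∣p∣+∣q∣ p q)
∣p∪q∣≤∣p∣+∣q∣ (false ∷ p) (true ∷ q)  =
  ≤-trans (s≤s (∣p∪q∣≤∣p∣+∣q∣ p q)) (≤-reflexive (sym (+-suc ∣ p ∣ ∣ q ∣)))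
∣p∪q∣≤∣p∣+∣q∣ (false ∷ p) (false ∷ q) = ∣p∪q∣≤∣p∣+∣q∣ p q

∣⁅x⁆∪⁅y⁆∣≤2 : (x y : Fin n) → ∣ ⁅ x ⁆ ∪ ⁅ y ⁆ ∣ ≤ 2
∣⁅x⁆∪⁅y⁆∣≤2 x y = ≤-trans (∣p∪q∣≤∣p∣+∣q∣ ⁅ x ⁆ ⁅ y ⁆)
  (≤-reflexive (cong₂ _+_ (∣⁅x⁆∣≡1 x) (∣⁅x⁆∣≡1 y)))

∣⁅x⁆∪⁅y⁆∪⁅z⁆∣≤3 : (x y z : Fin n) → ∣ ⁅ x ⁆ ∪ ⁅ y ⁆ ∪ ⁅ z ⁆ ∣ ≤ 3
∣⁅x⁆∪⁅y⁆∪⁅z⁆∣≤3 x y z = ≤-trans (∣p∪q∣≤∣p∣+∣q∣ ⁅ x ⁆ (⁅ y ⁆ ∪ ⁅ z ⁆))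
  (+-mono-≤ (≤-reflexive (∣⁅x⁆∣≡1 x)) (∣⁅x⁆∪⁅y⁆∣≤2 y z))

∈⁅x⁆∪⁅y⁆⁺ : ∀ {w x y : Fin n} → w ≡ x ⊎ w ≡ y → w ∈ ⁅ x ⁆ ∪ ⁅ y ⁆
∈⁅x⁆∪⁅y⁆⁺ (inj₁ refl) = x∈p∪q⁺ (inj₁ (x∈⁅x⁆ _))
∈⁅x⁆∪⁅y⁆⁺ (inj₂ refl) = x∈p∪q⁺ (inj₂ (x∈⁅x⁆ _))

∈⁅x⁆∪⁅y⁆∪⁅z⁆⁺ : ∀ {w x y z : Fin n} → w ≡ x ⊎ w ≡ y ⊎ w ≡ z → w ∈ ⁅ x ⁆ ∪ ⁅ y ⁆ ∪ ⁅ z ⁆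
∈⁅x⁆∪⁅y⁆∪⁅z⁆⁺ (inj₁ refl) = x∈p∪q⁺ (inj₁ (x∈⁅x⁆ _))
∈⁅x⁆∪⁅y⁆∪⁅z⁆⁺ (inj₂ w≡y⊎z) = x∈p∪q⁺ (inj₂ (∈⁅x⁆∪⁅y⁆⁺ w≡y⊎z))

x∈p⇒1≤∣p∣ : ∀ {x} {p : Subset n} → x ∈ p → 1 ≤ ∣ p ∣
x∈p⇒1≤∣p∣ x∈p = ≤-trans (s≤s z≤n) (x∈p⇒∣p-x∣<∣p∣ x∈p)

x,y∈p⇒2≤∣p∣ : ∀ {x y} {p : Subset n} → x ≢ y → x ∈ p → y ∈ p → 2 ≤ ∣ p ∣
x,y∈p⇒2≤∣p∣ x≢y x∈p y∈p =
  ≤-trans (s≤s (x∈p⇒1≤∣p∣ (x∈p∧x≢y⇒x∈p-y y∈p (x≢y ∘ sym)))) (x∈p⇒∣p-x∣<∣p∣ x∈p)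

x,y,z∈p⇒3≤∣p∣ : ∀ {x y z} {p : Subset n} → x ≢ y → x ≢ z → y ≢ z →
                x ∈ p → y ∈ p → z ∈ p → 3 ≤ ∣ p ∣
x,y,z∈p⇒3≤∣p∣ x≢y x≢z y≢z x∈p y∈p z∈p =
  ≤-trans (s≤s (x,y∈p⇒2≤∣p∣ y≢z (x∈p∧x≢y⇒x∈p-y y∈p (x≢y ∘ sym))
                                (x∈p∧x≢y⇒x∈p-y z∈p (x≢z ∘ sym))))
          (x∈p⇒∣p-x∣<∣p∣ x∈p)

∣p∣≤2⇒∈-pair : ∀ {x y w} {p : Subset n} → ∣ p ∣ ≤ 2 → x ≢ y → x ∈ p → y ∈ p → w ∈ p →
               w ≡ x ⊎ w ≡ y
∣p∣≤2⇒∈-pair {x = x} {y} {w} ∣p∣≤2 x≢y x∈p y∈p w∈p with w ≟ᶠ x | w ≟ᶠ y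
... | yes w≡x | _       = inj₁ w≡x
... | no _    | yes w≡y = inj₂ w≡y
... | no w≢x  | no w≢y  = ⊥-elim (<⇒≱ (s≤s (s≤s (s≤s z≤n)))
  (≤-trans (x,y,z∈p⇒3≤∣p∣ x≢y (w≢x ∘ sym) (w≢y ∘ sym) x∈p y∈p w∈p) ∣p∣≤2))

∀∈⇒n≤∣p∣ : {p : Subset n} → (∀ x → x ∈ p) → n ≤ ∣ p ∣
∀∈⇒n≤∣p∣ {n} {p} all∈ = subst (_≤ ∣ p ∣) (∣⊤∣≡n n) (p⊆q⇒∣p∣≤∣q∣ {p = ⊤} (λ {x} _ → all∈ x))

𝕀 : Bool → ℕ
𝕀 b = if b then 1 else 0

𝟙 : Subset n → Fin n → ℕ
𝟙 p = 𝕀 ∘ lookup p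

∣p∣≡∑𝟙 : (p : Subset n) → ∣ p ∣ ≡ sum (𝟙 p)
∣p∣≡∑𝟙 []          = refl
∣p∣≡∑𝟙 (true ∷ p)  = cong suc (∣p∣≡∑𝟙 p)
∣p∣≡∑𝟙 (false ∷ p) = ∣p∣≡∑𝟙 p

sum≤n : {f : Fin n → ℕ} → (∀ i → f i ≤ 1) → sum f ≤ n
sum≤n {zero}  _      = z≤n
sum≤n {suc n} f≤1 = +-mono-≤ (f≤1 fzero) (sum≤n (f≤1 ∘ fsuc))

lookup≡false⇒∉ : ∀ {x} {p : Subset n} → lookup p x ≡ false → x ∉ p
lookup≡false⇒∉ eq x∈p with () ← trans (sym ([]=⇒lookup x∈p)) eq

∈-tabulate⁻ : ∀ {P : Fin n → Set} (P? : ∀ x → Dec (P x)) {x} → x ∈ tabulate (does ∘ P?) → P x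
∈-tabulate⁻ P? {x} x∈ with P? x | trans (sym (lookup∘tabulate (does ∘ P?) x)) ([]=⇒lookup x∈)
... | yes Px | _  = Px
... | no _   | ()

IsLForcing-antitone : ∀ {G : Graph m} {S} {ℓ ℓ′} → ℓ ≤ ℓ′ → IsLForcing G ℓ′ S → IsLForcing G ℓ S
IsLForcing-antitone ℓ≤ℓ′ forcing L ∣L∣≤ℓ = forcing L (≤-trans ∣L∣≤ℓ ℓ≤ℓ′)

Adj⇒≢ : ∀ (G : Graph m) {u v} → Adj G u v → u ≢ v
Adj⇒≢ G u~v refl = Adj-irrefl G u~v

ForcingClosed : Graph m → Subset m → (Fin m → Set) → Set
ForcingClosed G L T = ∀ {u v} → T u → u ∉ L → Adj G u v → (∀ w → Adj G u w → w ≢ v → T w) → T v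

Colored⇒closed : ∀ {G : Graph m} {S L} {T : Fin m → Set} →
                 (∀ {v} → v ∈ S → T v) → ForcingClosed G L T → ∀ {v} → Colored G S L v → T v
Colored⇒closed S⊆T closed (init v∈S)             = S⊆T v∈S
Colored⇒closed S⊆T closed (force u u∉L u~v others) =
  closed (Colored⇒closed S⊆T closed u) u∉L u~v
         (λ w u~w w≢v → Colored⇒closed S⊆T closed (others w u~w w≢v))

record TwoNeighboursOutside (G : Graph m) (S : Subset m) (u : Fin m) : Set where
  constructor two
  field
    {x y} : Fin m
    x≢y   : x ≢ y
    u~x   : Adj G u x
    u~y   : Adj G u y
    x∉S   : x ∉ S
    y∉S   : y ∉ S

stalled⇒Colored⊆S : ∀ {G : Graph m} {S L} →
                    (∀ {u} → u ∈ S → u ∉ L → TwoNeighboursOutside G S u) →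
                    ∀ {v} → Colored G S L v → v ∈ S
stalled⇒Colored⊆S {G = G} {S} {L} stalled = Colored⇒closed (λ v∈S → v∈S) step
  where
  step : ForcingClosed G L (_∈ S)
  step {v = v} u∈S u∉L _ others with stalled u∈S u∉L
  ... | two {x} {y} x≢y u~x u~y x∉S y∉S with x ≟ᶠ v
  ...   | yes refl = ⊥-elim (y∉S (others y u~y (x≢y ∘ sym)))
  ...   | no x≢v   = ⊥-elim (x∉S (others x u~x x≢v))

pair-uncolored : ∀ {G : Graph m} {S L x y} → x ≢ y → x ∉ S → y ∉ S →
                 (∀ {u} → u ∉ L → u ≢ x → u ≢ y → Adj G u x → Adj G u y) →
                 (∀ {u} → u ∉ L → u ≢ x → u ≢ y → Adj G u y → Adj G u x) →
                 ¬ Colored G S L x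
pair-uncolored {m} {G} {S} {L} {x} {y} x≢y x∉S y∉S x⇒y y⇒x colored =
  proj₁ (Colored⇒closed avoids step colored) refl
  where
  Avoids : Fin m → Set
  Avoids v = v ≢ x × v ≢ y
  avoids : ∀ {v} → v ∈ S → Avoids v
  avoids v∈S = (λ { refl → x∉S v∈S }) , (λ { refl → y∉S v∈S })
  step : ForcingClosed G L Avoids
  step (u≢x , u≢y) u∉L u~v others =
    (λ { refl → proj₂ (others y (x⇒y u∉L u≢x u≢y u~v) (x≢y ∘ sym)) refl }) ,
    (λ { refl → proj₁ (others x (y⇒x u∉L u≢x u≢y u~v) x≢y) refl })

leaky-neighbourhood⇒∈ : ∀ {G : Graph m} {S L v} → IsLForcing G ℓ S → ∣ L ∣ ≤ ℓ →
                        (∀ u → Adj G u v → u ∈ L) → v ∈ S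
leaky-neighbourhood⇒∈ {G = G} {S} {L} {v} forcing ∣L∣≤ℓ leaky with v ∈? S
... | yes v∈S = v∈S
... | no v∉S  = ⊥-elim (uncolored (forcing L ∣L∣≤ℓ v))
  where
  uncolored : ¬ Colored G S L v
  uncolored (init v∈S)          = v∉S v∈S
  uncolored (force _ u∉L u~v _) = u∉L (leaky _ u~v)

record ThreeNeighbours (G : Graph m) (u : Fin m) : Set where
  constructor three
  field
    {x y z} : Fin m
    x≢y     : x ≢ y
    x≢z     : x ≢ z
    y≢z     : y ≢ z
    u~x     : Adj G u x
    u~y     : Adj G u y
    u~z     : Adj G u z

minDegree3⇒3≤∣S∣ : ∀ {G : Graph (suc m)} {S} → (∀ u → ThreeNeighbours G u) →
                   IsLForcing G ℓ S → 3 ≤ ∣ S ∣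
minDegree3⇒3≤∣S∣ {m} {ℓ} {G} {S} nbrs forcing with 3 ≤? ∣ S ∣
... | yes 3≤∣S∣ = 3≤∣S∣
... | no 3≰∣S∣  with nbrs fzero
...   | three x≢y x≢z y≢z _ _ _ = ⊥-elim (3≰∣S∣ (x,y,z∈p⇒3≤∣p∣ x≢y x≢z y≢z (all∈ _) (all∈ _) (all∈ _)))
  where
  atMostOneOf : ∀ {u a b} → u ∈ S → Adj G u a → Adj G u b → a ≢ b → a ∈ S → b ∉ S
  atMostOneOf u∈S u~a u~b a≢b a∈S b∈S =
    3≰∣S∣ (x,y,z∈p⇒3≤∣p∣ (Adj⇒≢ G u~a) (Adj⇒≢ G u~b) a≢b u∈S a∈S b∈S)
  stalled : ∀ {u} → u ∈ S → u ∉ ⊥ → TwoNeighboursOutside G S u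
  stalled {u} u∈S _ with nbrs u
  ... | three {a} {b} {c} a≢b a≢c b≢c u~a u~b u~c with a ∈? S
  ...   | yes a∈S = two b≢c u~b u~c (atMostOneOf u∈S u~a u~b a≢b a∈S) (atMostOneOf u∈S u~a u~c a≢c a∈S)
  ...   | no a∉S with b ∈? S
  ...     | yes b∈S = two a≢c u~a u~c a∉S (atMostOneOf u∈S u~b u~c b≢c b∈S)
  ...     | no b∉S  = two a≢b u~a u~b a∉S b∉S
  all∈ : ∀ v → v ∈ S
  all∈ v = stalled⇒Colored⊆S stalled (forcing ⊥ (subst (_≤ ℓ) (sym (∣⊥∣≡0 (suc m))) z≤n) v)

window-count : ∀ x y z → (x ≡ false → y ≡ true) → (y ≡ false → z ≡ true) → (x ≡ false → z ≡ true) →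
               𝕀 (x ∧ y ∧ z) + (𝕀 (not x) + 𝕀 (not y) + 𝕀 (not z)) ≤ 1
window-count true  true  true  _   _   _   = s≤s z≤n
window-count false true  true  _   _   _   = s≤s z≤n
window-count true  false true  _   _   _   = s≤s z≤n
window-count true  true  false _   _   _   = s≤s z≤n
window-count false false _     x⇒y _   _   with () ← x⇒y refl
window-count _     false false _   y⇒z _   with () ← y⇒z refl
window-count false true  false _   _   x⇒z with () ← x⇒z refl

[d+r]%n-wrap : ∀ d r n .{{_ : NonZero n}} → r < n → d ≤ n →
               (d + r) % n ≡ d + r ⊎ (d + r) % n + n ≡ d + r
[d+r]%n-wrap d r n r<n d≤n with d + r <? n
... | yes d+r<n = inj₁ (m<n⇒m%n≡m d+r<n)
... | no d+r≮n  = inj₂ (begin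
  (d + r) % n + n ≡⟨ cong (λ x → x % n + n) (sym (m∸n+n≡m n≤d+r)) ⟩
  (s + n) % n + n ≡⟨ cong (_+ n) ([m+n]%n≡m%n s n) ⟩
  s % n + n       ≡⟨ cong (_+ n) (m<n⇒m%n≡m s<n) ⟩
  s + n           ≡⟨ m∸n+n≡m n≤d+r ⟩
  d + r           ∎)
  where
  open ≡-Reasoning
  n≤d+r : n ≤ d + r
  n≤d+r = ≮⇒≥ d+r≮n
  s : ℕ
  s = d + r ∸ n
  s<n : s < n
  s<n = +-cancelʳ-< n s n (subst (_< n + n) (sym (m∸n+n≡m n≤d+r)) (+-mono-≤-< d≤n r<n))

[d+r]%n≢r : ∀ d r n .{{_ : NonZero n}} → 0 < d → d < n → r < n → (d + r) % n ≢ r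
[d+r]%n≢r d r n 0<d d<n r<n eq with [d+r]%n-wrap d r n r<n (<⇒≤ d<n)
... | inj₁ unwrapped = <⇒≢ (m<n+m r 0<d) (trans (sym eq) unwrapped)
... | inj₂ wrapped   = <⇒≢ d<n (+-cancelʳ-≡ r d n
  (trans (sym wrapped) (trans (cong (_+ n) eq) (+-comm r n))))

[d+j]%3≡[d+2]%3 : ∀ d j → j % 3 ≡ 2 → (d + j) % 3 ≡ (d + 2) % 3
[d+j]%3≡[d+2]%3 d j j%3≡2 =
  trans (%-distribˡ-+ d j 3) (trans (cong (λ x → (d % 3 + x) % 3) j%3≡2) (sym (%-distribˡ-+ d 2 3)))

[3+m]/3≡1+m/3 : ∀ m → (3 + m) / 3 ≡ suc (m / 3)
[3+m]/3≡1+m/3 m = m/n≡1+[m∸n]/n {3 + m} {3} (s≤s (s≤s (s≤s z≤n)))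

[2n+2]/3+n/3≡n : ∀ n → (2 * n + 2) / 3 + n / 3 ≡ n
[2n+2]/3+n/3≡n 0 = refl
[2n+2]/3+n/3≡n 1 = refl
[2n+2]/3+n/3≡n 2 = refl
[2n+2]/3+n/3≡n (suc (suc (suc n))) = begin
  (2 * (3 + n) + 2) / 3 + (3 + n) / 3       ≡⟨ cong (λ x → (x + 2) / 3 + (3 + n) / 3) (*-distribˡ-+ 2 3 n) ⟩
  (3 + (3 + (2 * n + 2))) / 3 + (3 + n) / 3 ≡⟨ cong₂ _+_ [6+x]/3 ([3+m]/3≡1+m/3 n) ⟩
  2 + (2 * n + 2) / 3 + suc (n / 3)         ≡⟨ cong (2 +_) (+-suc _ (n / 3)) ⟩
  3 + ((2 * n + 2) / 3 + n / 3)             ≡⟨ cong (3 +_) ([2n+2]/3+n/3≡n n) ⟩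
  3 + n                                     ∎
  where
  open ≡-Reasoning
  [6+x]/3 : (3 + (3 + (2 * n + 2))) / 3 ≡ 2 + (2 * n + 2) / 3
  [6+x]/3 = trans ([3+m]/3≡1+m/3 (3 + (2 * n + 2))) (cong suc ([3+m]/3≡1+m/3 (2 * n + 2)))

≤[2n+2]/3 : ∀ {n t h b} → t + h ≡ n → 3 * (b + h) ≤ n → (2 * n + 2) / 3 + b ≤ t
≤[2n+2]/3 {n} {t} {h} {b} t+h≡n 3[b+h]≤n = +-cancelʳ-≤ h _ t (begin
  (2 * n + 2) / 3 + b + h   ≡⟨ +-assoc _ b h ⟩
  (2 * n + 2) / 3 + (b + h) ≤⟨ +-monoʳ-≤ _ b+h≤n/3 ⟩
  (2 * n + 2) / 3 + n / 3   ≡⟨ [2n+2]/3+n/3≡n n ⟩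
  n                         ≡⟨ t+h≡n ⟨
  t + h                     ∎)
  where
  open ≤-Reasoning
  b+h≤n/3 : b + h ≤ n / 3
  b+h≤n/3 = subst (_≤ n / 3) (m*n/n≡m (b + h) 3) (/-monoˡ-≤ 3 (subst (_≤ n) (*-comm 3 (b + h)) 3[b+h]≤n))

∣i%3≡2∣ : ∀ n → ∣ tabulate {n} (λ i → does (toℕ i % 3 ≟ 2)) ∣ ≡ n / 3
∣i%3≡2∣ 0 = refl
∣i%3≡2∣ 1 = refl
∣i%3≡2∣ 2 = refl
∣i%3≡2∣ (suc (suc (suc n))) = trans (cong suc (∣i%3≡2∣ n)) (sym ([3+m]/3≡1+m/3 n))

module WheelProperties (k : ℕ) where

  N : ℕ
  N = 3 + k

  W : Graph (suc N)
  W = Wheel N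

  hub : Fin (suc N)
  hub = fzero

  rim : Fin N → Fin (suc N)
  rim = fsuc

  ix : ℕ → Fin N
  ix j = j mod N

  toℕ-ix : ∀ j → toℕ (ix j) ≡ j % N
  toℕ-ix j = toℕ-fromℕ< (m%n<n j N)

  ix-toℕ : ∀ i → ix (toℕ i) ≡ i
  ix-toℕ i = toℕ-injective (trans (toℕ-ix (toℕ i)) (m<n⇒m%n≡m (toℕ<n i)))

  ix-+N : ∀ j → ix (j + N) ≡ ix j
  ix-+N j = toℕ-injective (trans (toℕ-ix (j + N)) (trans ([m+n]%n≡m%n j N) (sym (toℕ-ix j))))

  ix-%ʳ : ∀ a j → ix (a + j % N) ≡ ix (a + j)
  ix-%ʳ a j = toℕ-injective (begin
    toℕ (ix (a + j % N))         ≡⟨ toℕ-ix (a + j % N) ⟩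
    (a + j % N) % N              ≡⟨ %-distribˡ-+ a (j % N) N ⟩
    (a % N + j % N % N) % N      ≡⟨ cong (λ x → (a % N + x) % N) (m%n%n≡m%n j N) ⟩
    (a % N + j % N) % N          ≡⟨ %-distribˡ-+ a j N ⟨
    (a + j) % N                  ≡⟨ toℕ-ix (a + j) ⟨
    toℕ (ix (a + j))             ∎)
    where open ≡-Reasoning

  ix-shift≢ : ∀ d j → 0 < d → d < N → ix (d + j) ≢ ix j
  ix-shift≢ d j 0<d d<N eq = [d+r]%n≢r d (j % N) N 0<d d<N (m%n<n j N)
    (trans (sym (toℕ-ix (d + j % N))) (trans (cong toℕ (trans (ix-%ʳ d j) eq)) (toℕ-ix j)))

  ix-injective : ∀ {a b} → 0 < a → a < b → b ≤ N → ix a ≢ ix b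
  ix-injective {a} {b} 0<a a<b b≤N eq =
    ix-shift≢ (b ∸ a) a (m<n⇒0<n∸m a<b) (<-≤-trans (∸-monoʳ-< 0<a (<⇒≤ a<b)) b≤N)
      (trans (cong ix (m∸n+n≡m (<⇒≤ a<b))) (sym eq))

  next prev : Fin N → Fin N
  next i = ix (1 + toℕ i)
  prev i = ix (2 + k + toℕ i)

  next-ix : ∀ j → next (ix j) ≡ ix (1 + j)
  next-ix j = trans (cong (λ x → ix (1 + x)) (toℕ-ix j)) (ix-%ʳ 1 j)

  next-prev : ∀ i → next (prev i) ≡ i
  next-prev i = begin
    next (ix (2 + k + toℕ i)) ≡⟨ next-ix (2 + k + toℕ i) ⟩
    ix (N + toℕ i)            ≡⟨ cong ix (+-comm N (toℕ i)) ⟩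
    ix (toℕ i + N)            ≡⟨ ix-+N (toℕ i) ⟩
    ix (toℕ i)                ≡⟨ ix-toℕ i ⟩
    i                         ∎
    where open ≡-Reasoning

  prev-next : ∀ i → prev (next i) ≡ i
  prev-next i = begin
    ix (2 + k + toℕ (ix (1 + toℕ i))) ≡⟨ cong (λ x → ix (2 + k + x)) (toℕ-ix (1 + toℕ i)) ⟩
    ix (2 + k + (1 + toℕ i) % N)      ≡⟨ ix-%ʳ (2 + k) (1 + toℕ i) ⟩
    ix (2 + k + (1 + toℕ i))          ≡⟨ cong ix (trans (+-suc (2 + k) (toℕ i)) (+-comm N (toℕ i))) ⟩
    ix (toℕ i + N)                    ≡⟨ ix-+N (toℕ i) ⟩
    ix (toℕ i)                        ≡⟨ ix-toℕ i ⟩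
    i                                 ∎
    where open ≡-Reasoning

  prev-ix-suc : ∀ j → prev (ix (1 + j)) ≡ ix j
  prev-ix-suc j = trans (cong prev (sym (next-ix j))) (prev-next (ix j))

  prev-injective : ∀ {i j} → prev i ≡ prev j → i ≡ j
  prev-injective {i} {j} eq = trans (sym (next-prev i)) (trans (cong next eq) (next-prev j))

  next≢ : ∀ i → next i ≢ i
  next≢ i eq = ix-shift≢ 1 (toℕ i) (s≤s z≤n) (s≤s (s≤s z≤n)) (trans eq (sym (ix-toℕ i)))

  next²≢ : ∀ i → next (next i) ≢ i
  next²≢ i eq = ix-shift≢ 2 (toℕ i) (s≤s z≤n) (s≤s (s≤s (s≤s z≤n)))
    (trans (sym (next-ix (1 + toℕ i))) (trans eq (sym (ix-toℕ i))))

  next≢prev : ∀ i → next i ≢ prev i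
  next≢prev i eq = next²≢ (prev i) (trans (cong next (next-prev i)) eq)

  hub~rim : ∀ i → Adj W hub (rim i)
  hub~rim i = tt

  rim~next : ∀ i → Adj W (rim i) (rim (next i))
  rim~next i = inj₁ (sym (toℕ-ix (1 + toℕ i))) , λ eq → next≢ i (sym eq)

  rim~prev : ∀ i → Adj W (rim i) (rim (prev i))
  rim~prev i = Adj-sym W (subst (λ j → Adj W (rim (prev i)) (rim j)) (next-prev i) (rim~next (prev i)))

  rim-neighbours : ∀ {i w} → Adj W (rim i) w → w ≡ hub ⊎ w ≡ rim (next i) ⊎ w ≡ rim (prev i)
  rim-neighbours {w = fzero}  _ = inj₁ refl
  rim-neighbours {i} {fsuc j} (inj₁ i→j , _) =
    inj₂ (inj₁ (cong rim (toℕ-injective (trans (sym i→j) (sym (toℕ-ix (1 + toℕ i)))))))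
  rim-neighbours {i} {fsuc j} (inj₂ j→i , _) =
    inj₂ (inj₂ (cong rim (trans (sym (prev-next j))
      (cong prev (toℕ-injective (trans (toℕ-ix (1 + toℕ j)) j→i))))))

  hub≢rim : ∀ {i} → hub ≢ rim i
  hub≢rim ()

  rim-injective : ∀ {i j} → rim i ≡ rim j → i ≡ j
  rim-injective refl = refl

  threeNeighbours : ∀ u → ThreeNeighbours W u
  threeNeighbours fzero =
    three {x = rim (ix 0)} {rim (ix 1)} {rim (ix 2)} (λ ()) (λ ()) (λ ()) tt tt tt
  threeNeighbours (fsuc i) = three hub≢rim hub≢rim (next≢prev i ∘ rim-injective) tt (rim~next i) (rim~prev i)

  rotation : Permutation N N
  rotation = permutation next prev next-prev prev-next

  ∑∘next : ∀ f → sum (f ∘ next) ≡ sum f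
  ∑∘next f = sym (sum-permute f rotation)

  ∑∘prev : ∀ f → sum (f ∘ prev) ≡ sum f
  ∑∘prev f = sym (sum-permute f (flip rotation))

  module _ {S L : Subset (suc N)} where

    rim-forces-next : ∀ {i} → Colored W S L hub → Colored W S L (rim (prev i)) → Colored W S L (rim i) →
                      rim i ∉ L → Colored W S L (rim (next i))
    rim-forces-next {i} hub● prev● i● i∉L = force i● i∉L (rim~next i) others
      where
      others : ∀ w → Adj W (rim i) w → w ≢ rim (next i) → Colored W S L w
      others w i~w w≢next with rim-neighbours i~w
      ... | inj₁ refl        = hub●
      ... | inj₂ (inj₁ refl) = ⊥-elim (w≢next refl)
      ... | inj₂ (inj₂ refl) = prev●

    rim-forces-prev : ∀ {i} → Colored W S L hub → Colored W S L (rim (next i)) → Colored W S L (rim i) →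
                      rim i ∉ L → Colored W S L (rim (prev i))
    rim-forces-prev {i} hub● next● i● i∉L = force i● i∉L (rim~prev i) others
      where
      others : ∀ w → Adj W (rim i) w → w ≢ rim (prev i) → Colored W S L w
      others w i~w w≢prev with rim-neighbours i~w
      ... | inj₁ refl        = hub●
      ... | inj₂ (inj₁ refl) = next●
      ... | inj₂ (inj₂ refl) = ⊥-elim (w≢prev refl)

    forward-chain : Colored W S L hub → Colored W S L (rim (ix 0)) → Colored W S L (rim (ix 1)) →
                    ∀ d → (∀ e → e < d → rim (ix (1 + e)) ∉ L) →
                    Colored W S L (rim (ix d)) × Colored W S L (rim (ix (1 + d)))
    forward-chain hub● 0● 1● zero    _      = 0● , 1●
    forward-chain hub● 0● 1● (suc d) sealed with forward-chain hub● 0● 1● d (λ e e<d → sealed e (m<n⇒m<1+n e<d))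
    ... | d● , 1+d● = 1+d● , subst (Colored W S L ∘ rim) (next-ix (1 + d))
      (rim-forces-next hub● (subst (Colored W S L ∘ rim) (sym (prev-ix-suc d)) d●) 1+d● (sealed d ≤-refl))

    backward-chain : Colored W S L hub → ∀ d t → Colored W S L (rim (ix (d + t))) →
                     Colored W S L (rim (ix (1 + (d + t)))) → (∀ e → e < d → rim (ix (1 + (e + t))) ∉ L) →
                     Colored W S L (rim (ix t))
    backward-chain hub● zero    t t● _    _      = t●
    backward-chain hub● (suc d) t d+1● d+2● sealed =
      backward-chain hub● d t d+t● d+1● (λ e e<d → sealed e (m<n⇒m<1+n e<d))
      where
      d+t● : Colored W S L (rim (ix (d + t)))
      d+t● = subst (Colored W S L ∘ rim) (prev-ix-suc (d + t))
        (rim-forces-prev hub● (subst (Colored W S L ∘ rim) (sym (next-ix (1 + (d + t)))) d+2●) d+1● (sealed d ≤-refl))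

  S₁ : Subset (suc N)
  S₁ = inside ∷ inside ∷ inside ∷ ⊥

  -- If a leak at position 1 + e < t stops the forward sweep from positions 0, 1, then positions
  -- t + 1, …, N are leak-free and the backward sweep from positions N, N + 1 reaches t.
  S₁-1-forcing : IsLForcing W 1 S₁
  S₁-1-forcing L ∣L∣≤1 fzero    = init here
  S₁-1-forcing L ∣L∣≤1 (fsuc i) = subst (Colored W S₁ L ∘ rim) (ix-toℕ i) (rim● (toℕ i) (toℕ<n i))
    where
    hub● : Colored W S₁ L hub
    hub● = init here
    0● : Colored W S₁ L (rim (ix 0))
    0● = init (there here)
    1● : Colored W S₁ L (rim (ix 1))
    1● = init (there (there here))
    rim● : ∀ t → t < N → Colored W S₁ L (rim (ix t))
    rim● zero    _   = 0●
    rim● (suc d) t<N with anyUpTo? (λ e → rim (ix (1 + e)) ∈? L) d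
    ... | no unsealed = proj₂ (forward-chain hub● 0● 1● d (λ e e<d leak → unsealed (e , e<d , leak)))
    ... | yes (e , e<d , leak) = backward-chain hub● (N ∸ suc d) (suc d) N● N+1● sealed
      where
      N∸t+t≡N : N ∸ suc d + suc d ≡ N
      N∸t+t≡N = m∸n+n≡m (<⇒≤ t<N)
      N● : Colored W S₁ L (rim (ix (N ∸ suc d + suc d)))
      N● = subst (Colored W S₁ L ∘ rim) (sym (trans (cong ix N∸t+t≡N) (ix-+N 0))) 0●
      N+1● : Colored W S₁ L (rim (ix (1 + (N ∸ suc d + suc d))))
      N+1● = subst (Colored W S₁ L ∘ rim) (sym (trans (cong (ix ∘ suc) N∸t+t≡N) (ix-+N 1))) 1●
      sealed : ∀ e′ → e′ < N ∸ suc d → rim (ix (1 + (e′ + suc d))) ∉ L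
      sealed e′ e′<N∸t leak′ = <⇒≱ (s≤s (s≤s z≤n)) (≤-trans (x,y∈p⇒2≤∣p∣ distinct leak leak′) ∣L∣≤1)
        where
        distinct : rim (ix (1 + e)) ≢ rim (ix (1 + (e′ + suc d)))
        distinct = ix-injective (s≤s z≤n) (s≤s (<-≤-trans (m<n⇒m<1+n e<d) (m≤n+m (suc d) e′)))
                     (subst (e′ + suc d <_) N∸t+t≡N (+-monoˡ-< (suc d) e′<N∸t)) ∘ rim-injective

  ∣S₁∣≡3 : ∣ S₁ ∣ ≡ 3
  ∣S₁∣≡3 = cong (3 +_) (∣⊥∣≡0 (suc k))

  Z-ℓ≤1 : ℓ ≤ 1 → ZeroForcingℓ≡ W ℓ 3
  Z-ℓ≤1 ℓ≤1 = (S₁ , IsLForcing-antitone ℓ≤1 S₁-1-forcing , ∣S₁∣≡3) ,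
              λ _ forcing → minDegree3⇒3≤∣S∣ threeNeighbours forcing

  rim∈forcing-set : ∀ {S} → IsLForcing W ℓ S → 3 ≤ ℓ → ∀ i → rim i ∈ S
  rim∈forcing-set forcing 3≤ℓ i = leaky-neighbourhood⇒∈ forcing
    (≤-trans (∣⁅x⁆∪⁅y⁆∪⁅z⁆∣≤3 hub (rim (next i)) (rim (prev i))) 3≤ℓ)
    (λ u u~i → ∈⁅x⁆∪⁅y⁆∪⁅z⁆⁺ (rim-neighbours (Adj-sym W u~i)))

  hub∈forcing-set : ∀ {S} → IsLForcing W ℓ S → N ≤ ℓ → hub ∈ S
  hub∈forcing-set {ℓ} forcing N≤ℓ = leaky-neighbourhood⇒∈ {L = outside ∷ ⊤} forcing
    (subst (_≤ ℓ) (sym (∣⊤∣≡n N)) N≤ℓ) rim∈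
    where
    rim∈ : ∀ u → Adj W u hub → u ∈ outside ∷ ⊤
    rim∈ (fsuc _) _ = there ∈⊤

  all-rim-forcing : ℓ < N → IsLForcing W ℓ (outside ∷ ⊤)
  all-rim-forcing ℓ<N L         ∣L∣≤ℓ (fsuc i) = init (there ∈⊤)
  all-rim-forcing ℓ<N (l ∷ L′) ∣L∣≤ℓ fzero
    with ¬∀⟶∃¬ N (_∈ L′) (_∈? L′)
           (λ all∈ → <⇒≱ ℓ<N (≤-trans (∀∈⇒n≤∣p∣ all∈) (≤-trans (∣p∣≤∣x∷p∣ l L′) ∣L∣≤ℓ)))
  ... | j , j∉L′ = force (init (there ∈⊤)) (j∉L′ ∘ drop-there) (hub~rim j) others
    where
    others : ∀ w → Adj W (rim j) w → w ≢ hub → Colored W (outside ∷ ⊤) (l ∷ L′) w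
    others fzero    _ w≢hub = ⊥-elim (w≢hub refl)
    others (fsuc w) _ _     = init (there ∈⊤)

  Z-2<ℓ<N : 2 < ℓ → ℓ < N → ZeroForcingℓ≡ W ℓ N
  Z-2<ℓ<N {ℓ} 2<ℓ ℓ<N = (outside ∷ ⊤ , all-rim-forcing ℓ<N , ∣⊤∣≡n N) , lower
    where
    lower : ∀ S → IsLForcing W ℓ S → N ≤ ∣ S ∣
    lower (s ∷ T) forcing =
      ≤-trans (∀∈⇒n≤∣p∣ (λ i → drop-there (rim∈forcing-set forcing 2<ℓ i))) (∣p∣≤∣x∷p∣ s T)

  Z-N≤ℓ : N ≤ ℓ → ZeroForcingℓ≡ W ℓ (suc N)
  Z-N≤ℓ {ℓ} N≤ℓ = (⊤ , (λ _ _ _ → init ∈⊤) , ∣⊤∣≡n (suc N)) , λ _ forcing → ∀∈⇒n≤∣p∣ (all∈ forcing)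
    where
    all∈ : ∀ {S} → IsLForcing W ℓ S → ∀ v → v ∈ S
    all∈ forcing fzero    = hub∈forcing-set forcing N≤ℓ
    all∈ forcing (fsuc i) = rim∈forcing-set forcing (≤-trans (s≤s (s≤s (s≤s z≤n))) N≤ℓ) i

  -- The ⌊N/3⌋ positions ≡ 2 (mod 3) are pairwise at distance at least 3 on the rim, also
  -- across the wrap-around, since the first is 2 and the last at most N ∸ 1.
  Hole : Fin N → Set
  Hole i = toℕ i % 3 ≡ 2

  hole? : ∀ i → Dec (Hole i)
  hole? i = toℕ i % 3 ≟ 2

  hole⇒¬hole-at : ∀ d → d ≤ 2 → (d + 2) % 3 ≢ 2 → ∀ i → Hole i → ¬ Hole (ix (d + toℕ i))
  hole⇒¬hole-at d d≤2 [d+2]%3≢2 i hole hole′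
    with [d+r]%n-wrap d (toℕ i) N (toℕ<n i) (≤-trans d≤2 (s≤s (s≤s z≤n)))
  ... | inj₁ unwrapped = [d+2]%3≢2 (begin
    (d + 2) % 3              ≡⟨ [d+j]%3≡[d+2]%3 d (toℕ i) hole ⟨
    (d + toℕ i) % 3          ≡⟨ cong (_% 3) (trans (sym unwrapped) (sym (toℕ-ix (d + toℕ i)))) ⟩
    toℕ (ix (d + toℕ i)) % 3 ≡⟨ hole′ ⟩
    2                        ∎)
    where open ≡-Reasoning
  ... | inj₂ wrapped = <⇒≢ x<2 (trans (sym (m<n⇒m%n≡m (m<n⇒m<1+n x<2))) hole′)
    where
    x : ℕ
    x = toℕ (ix (d + toℕ i))
    x<2 : x < 2
    x<2 = <-≤-trans (+-cancelʳ-< N x d (begin-strict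
      x + N               ≡⟨ cong (_+ N) (toℕ-ix (d + toℕ i)) ⟩
      (d + toℕ i) % N + N ≡⟨ wrapped ⟩
      d + toℕ i           <⟨ +-monoʳ-< d (toℕ<n i) ⟩
      d + N               ∎)) d≤2
      where open ≤-Reasoning

  hole⇒¬hole-next : ∀ i → Hole i → ¬ Hole (next i)
  hole⇒¬hole-next = hole⇒¬hole-at 1 (s≤s z≤n) (λ ())

  hole⇒¬hole-next² : ∀ i → Hole i → ¬ Hole (next (next i))
  hole⇒¬hole-next² i hole = hole⇒¬hole-at 2 ≤-refl (λ ()) i hole ∘ subst Hole (next-ix (1 + toℕ i))

  hole⇒¬hole-prev : ∀ i → Hole i → ¬ Hole (prev i)
  hole⇒¬hole-prev i hole hole′ = hole⇒¬hole-next (prev i) hole′ (subst Hole (sym (next-prev i)) hole)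

  hole⇒¬hole-prev² : ∀ i → Hole i → ¬ Hole (prev (prev i))
  hole⇒¬hole-prev² i hole hole′ =
    hole⇒¬hole-next² (prev (prev i)) hole′ (subst Hole (sym (trans (cong next (next-prev (prev i))) (next-prev i))) hole)

  Holes : Subset N
  Holes = tabulate (does ∘ hole?)

  S₂ : Subset (suc N)
  S₂ = inside ∷ ∁ Holes

  solid∈S₂ : ∀ {i} → ¬ Hole i → rim i ∈ S₂
  solid∈S₂ ¬hole = there (x∉p⇒x∈∁p (¬hole ∘ ∈-tabulate⁻ hole?))

  ∣S₂∣≡[2N+2]/3+1 : ∣ S₂ ∣ ≡ (2 * N + 2) / 3 + 1
  ∣S₂∣≡[2N+2]/3+1 = begin
    suc ∣ ∁ Holes ∣               ≡⟨ cong suc (∣∁p∣≡n∸∣p∣ Holes) ⟩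
    suc (N ∸ ∣ Holes ∣)           ≡⟨ cong (λ h → suc (N ∸ h)) (∣i%3≡2∣ N) ⟩
    suc (N ∸ N / 3)               ≡⟨ cong (λ m → suc (m ∸ N / 3)) ([2n+2]/3+n/3≡n N) ⟨
    suc (⌈2N/3⌉ + N / 3 ∸ N / 3)  ≡⟨ cong suc (m+n∸n≡m ⌈2N/3⌉ (N / 3)) ⟩
    suc ⌈2N/3⌉                    ≡⟨ +-comm 1 ⌈2N/3⌉ ⟩
    ⌈2N/3⌉ + 1                    ∎
    where
    open ≡-Reasoning
    ⌈2N/3⌉ : ℕ
    ⌈2N/3⌉ = (2 * N + 2) / 3

  module _ {L : Subset (suc N)} where

    hole-forced-from-prev : ∀ i → Hole i → rim (prev i) ∉ L → Colored W S₂ L (rim i)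
    hole-forced-from-prev i hole prev∉L = subst (Colored W S₂ L ∘ rim) (next-prev i)
      (rim-forces-next (init here) (init (solid∈S₂ (hole⇒¬hole-prev² i hole)))
                       (init (solid∈S₂ (hole⇒¬hole-prev i hole))) prev∉L)

    hole-forced-from-next : ∀ i → Hole i → rim (next i) ∉ L → Colored W S₂ L (rim i)
    hole-forced-from-next i hole next∉L = subst (Colored W S₂ L ∘ rim) (prev-next i)
      (rim-forces-prev (init here) (init (solid∈S₂ (hole⇒¬hole-next² i hole)))
                       (init (solid∈S₂ (hole⇒¬hole-next i hole))) next∉L)

  S₂-2-forcing : IsLForcing W 2 S₂
  S₂-2-forcing L ∣L∣≤2 fzero = init here
  S₂-2-forcing L ∣L∣≤2 (fsuc i) with hole? i
  ... | no solid = init (solid∈S₂ solid)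
  ... | yes hole with rim (prev i) ∈? L | rim (next i) ∈? L
  ...   | no prev∉L  | _          = hole-forced-from-prev i hole prev∉L
  ...   | yes _      | no next∉L  = hole-forced-from-next i hole next∉L
  ...   | yes prev∈L | yes next∈L = force (init here) hub∉L (hub~rim i) others
    where
    prev≢next : rim (prev i) ≢ rim (next i)
    prev≢next = next≢prev i ∘ sym ∘ rim-injective
    hub∉L : hub ∉ L
    hub∉L hub∈L = <⇒≱ (s≤s (s≤s (s≤s z≤n)))
      (≤-trans (x,y,z∈p⇒3≤∣p∣ hub≢rim hub≢rim prev≢next hub∈L prev∈L next∈L) ∣L∣≤2)
    others : ∀ w → Adj W hub w → w ≢ rim i → Colored W S₂ L w
    others (fsuc j) _ j≢i with hole? j
    ... | no solid = init (solid∈S₂ solid)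
    ... | yes hole′ with rim (prev j) ∈? L
    ...   | no prevⱼ∉L = hole-forced-from-prev j hole′ prevⱼ∉L
    ...   | yes prevⱼ∈L with ∣p∣≤2⇒∈-pair ∣L∣≤2 prev≢next prev∈L next∈L prevⱼ∈L
    ...     | inj₁ prevⱼ≡prev = ⊥-elim (j≢i (cong rim (prev-injective (rim-injective prevⱼ≡prev))))
    ...     | inj₂ prevⱼ≡next = ⊥-elim (hole⇒¬hole-next² i hole (subst Hole j≡next² hole′))
      where
      j≡next² : j ≡ next (next i)
      j≡next² = trans (sym (next-prev j)) (cong next (rim-injective prevⱼ≡next))

  module LowerBound₂ {s : Bool} {T : Subset N} (forcing : IsLForcing W 2 (s ∷ T)) where

    rim∉ : ∀ {i} → i ∉ T → rim i ∉ s ∷ T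
    rim∉ i∉T = i∉T ∘ drop-there

    -- Leaking the outer neighbours of two holes at distance one or two leaves them shielded:
    -- every unleaked vertex adjacent to one of them is adjacent to the other.
    hole⇒next∈ : ∀ i → i ∉ T → next i ∈ T
    hole⇒next∈ i i∉T with next i ∈? T
    ... | yes next∈T = next∈T
    ... | no next∉T  = ⊥-elim (pair-uncolored (next≢ i ∘ sym ∘ rim-injective) (rim∉ i∉T) (rim∉ next∉T)
      i⇒next next⇒i (forcing L (∣⁅x⁆∪⁅y⁆∣≤2 (rim (prev i)) (rim (next (next i)))) (rim i)))
      where
      L : Subset (suc N)
      L = ⁅ rim (prev i) ⁆ ∪ ⁅ rim (next (next i)) ⁆
      i⇒next : ∀ {u} → u ∉ L → u ≢ rim i → u ≢ rim (next i) → Adj W u (rim i) → Adj W u (rim (next i))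
      i⇒next u∉L u≢i u≢next u~i with rim-neighbours (Adj-sym W u~i)
      ... | inj₁ refl        = hub~rim (next i)
      ... | inj₂ (inj₁ refl) = ⊥-elim (u≢next refl)
      ... | inj₂ (inj₂ refl) = ⊥-elim (u∉L (x∈p∪q⁺ (inj₁ (x∈⁅x⁆ _))))
      next⇒i : ∀ {u} → u ∉ L → u ≢ rim i → u ≢ rim (next i) → Adj W u (rim (next i)) → Adj W u (rim i)
      next⇒i u∉L u≢i u≢next u~next with rim-neighbours (Adj-sym W u~next)
      ... | inj₁ refl        = hub~rim i
      ... | inj₂ (inj₁ refl) = ⊥-elim (u∉L (x∈p∪q⁺ (inj₂ (x∈⁅x⁆ _))))
      ... | inj₂ (inj₂ refl) = ⊥-elim (u≢i (cong rim (prev-next i)))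

    hole⇒next²∈ : ∀ i → i ∉ T → next (next i) ∈ T
    hole⇒next²∈ i i∉T with next (next i) ∈? T
    ... | yes next²∈T = next²∈T
    ... | no next²∉T  = ⊥-elim (pair-uncolored (next²≢ i ∘ sym ∘ rim-injective) (rim∉ i∉T) (rim∉ next²∉T)
      i⇒next² next²⇒i (forcing L (∣⁅x⁆∪⁅y⁆∣≤2 (rim (prev i)) (rim (next (next (next i))))) (rim i)))
      where
      L : Subset (suc N)
      L = ⁅ rim (prev i) ⁆ ∪ ⁅ rim (next (next (next i))) ⁆
      i⇒next² : ∀ {u} → u ∉ L → u ≢ rim i → u ≢ rim (next (next i)) →
                Adj W u (rim i) → Adj W u (rim (next (next i)))
      i⇒next² u∉L _ _ u~i with rim-neighbours (Adj-sym W u~i)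
      ... | inj₁ refl        = hub~rim (next (next i))
      ... | inj₂ (inj₁ refl) = rim~next (next i)
      ... | inj₂ (inj₂ refl) = ⊥-elim (u∉L (x∈p∪q⁺ (inj₁ (x∈⁅x⁆ _))))
      next²⇒i : ∀ {u} → u ∉ L → u ≢ rim i → u ≢ rim (next (next i)) →
                Adj W u (rim (next (next i))) → Adj W u (rim i)
      next²⇒i u∉L _ _ u~next² with rim-neighbours (Adj-sym W u~next²)
      ... | inj₁ refl        = hub~rim i
      ... | inj₂ (inj₁ refl) = ⊥-elim (u∉L (x∈p∪q⁺ (inj₂ (x∈⁅x⁆ _))))
      ... | inj₂ (inj₂ refl) = subst (λ j → Adj W (rim j) (rim i)) (sym (prev-next (next i)))
                                 (subst (λ j → Adj W (rim (next i)) (rim j)) (prev-next i) (rim~prev (next i)))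

    full : Fin N → Bool
    full i = lookup T (prev i) ∧ lookup T i ∧ lookup T (next i)

    Full : Subset N
    Full = tabulate full

    ∈Full : ∀ {i} → prev i ∈ T → i ∈ T → next i ∈ T → i ∈ Full
    ∈Full {i} prev∈T i∈T next∈T = lookup⇒[]= i Full (trans (lookup∘tabulate full i)
      (cong₂ _∧_ ([]=⇒lookup prev∈T) (cong₂ _∧_ ([]=⇒lookup i∈T) ([]=⇒lookup next∈T))))

    window : ∀ i → 𝟙 Full i + (𝟙 (∁ T) (prev i) + 𝟙 (∁ T) i + 𝟙 (∁ T) (next i)) ≤ 1
    window i = subst (_≤ 1) (sym (cong₂ _+_ (cong 𝕀 (lookup∘tabulate full i))
                 (cong₂ _+_ (cong₂ _+_ (𝟙∁ (prev i)) (𝟙∁ i)) (𝟙∁ (next i)))))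
                 (window-count _ _ _ prev⇒i i⇒next prev⇒next)
      where
      𝟙∁ : ∀ j → 𝟙 (∁ T) j ≡ 𝕀 (not (lookup T j))
      𝟙∁ j = cong 𝕀 (lookup-map j not T)
      in-T : ∀ {j j′} → j ≡ j′ → j ∈ T → lookup T j′ ≡ true
      in-T refl = []=⇒lookup
      prev⇒i : lookup T (prev i) ≡ false → lookup T i ≡ true
      prev⇒i eq = in-T (next-prev i) (hole⇒next∈ (prev i) (lookup≡false⇒∉ eq))
      i⇒next : lookup T i ≡ false → lookup T (next i) ≡ true
      i⇒next eq = in-T refl (hole⇒next∈ i (lookup≡false⇒∉ eq))
      prev⇒next : lookup T (prev i) ≡ false → lookup T (next i) ≡ true
      prev⇒next eq = in-T (cong next (next-prev i)) (hole⇒next²∈ (prev i) (lookup≡false⇒∉ eq))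

    ∣Full∣+3∣∁T∣≤N : ∣ Full ∣ + 3 * ∣ ∁ T ∣ ≤ N
    ∣Full∣+3∣∁T∣≤N = begin
      ∣ Full ∣ + 3 * ∣ ∁ T ∣                            ≡⟨ cong₂ _+_ (∣p∣≡∑𝟙 Full) (cong (3 *_) (∣p∣≡∑𝟙 (∁ T))) ⟩
      sum f + 3 * sum h                                 ≡⟨ cong (sum f +_) (3*x≡x+x+x (sum h)) ⟩
      sum f + (sum h + sum h + sum h)                   ≡⟨ cong (λ x → sum f + (x + sum h + sum h)) (∑∘prev h) ⟨
      sum f + (sum (h ∘ prev) + sum h + sum h)          ≡⟨ cong (λ x → sum f + (sum (h ∘ prev) + sum h + x)) (∑∘next h) ⟨
      sum f + (sum (h ∘ prev) + sum h + sum (h ∘ next)) ≡⟨ cong (sum f +_) (trans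
        (∑-distrib-+ (λ i → h (prev i) + h i) (h ∘ next)) (cong (_+ sum (h ∘ next)) (∑-distrib-+ (h ∘ prev) h))) ⟨
      sum f + sum (λ i → h (prev i) + h i + h (next i)) ≡⟨ ∑-distrib-+ f (λ i → h (prev i) + h i + h (next i)) ⟨
      sum (λ i → f i + (h (prev i) + h i + h (next i))) ≤⟨ sum≤n window ⟩
      N                                                 ∎
      where
      open ≤-Reasoning
      f h : Fin N → ℕ
      f = 𝟙 Full
      h = 𝟙 (∁ T)
      3*x≡x+x+x : ∀ x → 3 * x ≡ x + x + x
      3*x≡x+x+x x = trans (cong (λ y → x + (x + y)) (+-identityʳ x)) (sym (+-assoc x x x))

    -- Leaking the middles of the full windows stalls S: every other rim vertex of S has the
    -- hub and a hole as uncoloured neighbours.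
    hub∉S⇒3≤∣Full∣ : hub ∉ s ∷ T → 3 ≤ ∣ Full ∣
    hub∉S⇒3≤∣Full∣ hub∉S with 3 ≤? ∣ Full ∣
    ... | yes 3≤∣Full∣ = 3≤∣Full∣
    ... | no 3≰∣Full∣  =
      ⊥-elim (hub∉S (stalled⇒Colored⊆S stalled (forcing (outside ∷ Full) (s≤s⁻¹ (≰⇒> 3≰∣Full∣)) hub)))
      where
      stalled : ∀ {u} → u ∈ s ∷ T → u ∉ outside ∷ Full → TwoNeighboursOutside W (s ∷ T) u
      stalled {fzero}  hub∈S _ = ⊥-elim (hub∉S hub∈S)
      stalled {fsuc j} j∈S j∉L with prev j ∈? T | next j ∈? T
      ... | yes prev∈T | yes next∈T = ⊥-elim (j∉L (there (∈Full prev∈T (drop-there j∈S) next∈T)))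
      ... | no prev∉T  | _          = two hub≢rim tt (rim~prev j) hub∉S (rim∉ prev∉T)
      ... | yes _      | no next∉T  = two hub≢rim tt (rim~next j) hub∉S (rim∉ next∉T)

    ∣T∣+∣∁T∣≡N : ∣ T ∣ + ∣ ∁ T ∣ ≡ N
    ∣T∣+∣∁T∣≡N = trans (cong (∣ T ∣ +_) (∣∁p∣≡n∸∣p∣ T)) (m+[n∸m]≡n (∣p∣≤n T))

  lower-bound₂ : ∀ S → IsLForcing W 2 S → (2 * N + 2) / 3 + 1 ≤ ∣ S ∣
  lower-bound₂ (true ∷ T) forcing = ≤-trans (≤-reflexive (+-comm ((2 * N + 2) / 3) 1))
    (s≤s (subst (_≤ ∣ T ∣) (+-identityʳ _) (≤[2n+2]/3 ∣T∣+∣∁T∣≡N (≤-trans (m≤n+m _ ∣ Full ∣) ∣Full∣+3∣∁T∣≤N))))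
    where open LowerBound₂ forcing
  lower-bound₂ (false ∷ T) forcing = ≤[2n+2]/3 ∣T∣+∣∁T∣≡N (begin
    3 * (1 + ∣ ∁ T ∣)      ≡⟨ *-distribˡ-+ 3 1 ∣ ∁ T ∣ ⟩
    3 + 3 * ∣ ∁ T ∣        ≤⟨ +-monoˡ-≤ (3 * ∣ ∁ T ∣) (hub∉S⇒3≤∣Full∣ λ ()) ⟩
    ∣ Full ∣ + 3 * ∣ ∁ T ∣ ≤⟨ ∣Full∣+3∣∁T∣≤N ⟩
    N                      ∎)
    where
    open LowerBound₂ forcing
    open ≤-Reasoning

  Z-ℓ≡2 : ZeroForcingℓ≡ W 2 ((2 * N + 2) / 3 + 1)
  Z-ℓ≡2 = (S₂ , S₂-2-forcing , ∣S₂∣≡[2N+2]/3+1) , lower-bound₂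

proposition14 : (n ℓ : ℕ) → 3 ≤ n →
    ((ℓ ≡ 0 ⊎ ℓ ≡ 1) → ZeroForcingℓ≡ (Wheel n) ℓ 3)
    × (ℓ ≡ 2 → ZeroForcingℓ≡ (Wheel n) ℓ ((2 * n + 2) / 3 + 1))
    × (2 < ℓ → ℓ < n → ZeroForcingℓ≡ (Wheel n) ℓ n)
    × ((ℓ ≡ n ⊎ ℓ ≡ suc n) → ZeroForcingℓ≡ (Wheel n) ℓ (suc n))
proposition14 (suc (suc (suc k))) ℓ (s≤s (s≤s (s≤s z≤n))) =
  (λ { (inj₁ refl) → Z-ℓ≤1 z≤n ; (inj₂ refl) → Z-ℓ≤1 ≤-refl }) ,
  (λ { refl → Z-ℓ≡2 }) ,
  Z-2<ℓ<N ,
  (λ { (inj₁ refl) → Z-N≤ℓ ≤-refl ; (inj₂ refl) → Z-N≤ℓ (n≤1+n _) })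
  where open WheelProperties k
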